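{- The family $\mathcal{F}$ of oriented graphs whose underlying graph is a partial $2$-tree is not optimally simply colourable, i.e. $\chi_s(\mathcal{F})\neq\chi(\mathcal{F})$.
   Context: An oriented graph is a loopless digraph with at most one arc between any pair of vertices. A homomorphism $\phi: G\to H$ of oriented graphs is a map $V(G)\to V(H)$ such that for every arc $uv$ of $G$, $\phi(u)\phi(v)$ is an arc of $H$ (in particular $\phi(u)\neq\phi(v)$); $\chi(G)$ is the least number of vertices of an $H$ with $G\to H$. A simple homomorphism $\phi: G\to_s H$ is a map such that either $|V(G)|=1$, or $\phi$ is non-constant and every arc $uv$ with $\phi(u)\neq\phi(v)$ maps to an arc $\phi(u)\phi(v)$ of $H$; $\chi_s(G)$ is the least number of vertices of an $H$ with $G\to_s H$. For a family $\mathcal{F}$, $\chi(\mathcal{F})$ (resp. $\chi_s(\mathcal{F})$) is the maximum of $\chi(G)$ (resp. $\chi_s(G)$) over $G\in\mathcal{F}$ ($\infty$ if no maximum exists); $\mathcal{F}$ is optimally simply colourable if these are equal. A partial $2$-tree is a subgraph of a $2$-tree. -}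

module Defs where

open import Data.Nat using (ℕ; zero; suc; _≤_)
open import Data.Fin using (Fin; zero; suc; _≟_)
open import Data.Bool using (Bool; true; false; _∨_)
open import Data.Product using (Σ; ∃; _×_; _,_)
open import Data.Sum using (_⊎_)
open import Data.Maybe using (Maybe; just; nothing)
open import Relation.Nullary using (¬_)
open import Relation.Nullary.Decidable using (⌊_⌋)
open import Relation.Binary.PropositionalEquality using (_≡_; _≢_)

record OGraph : Set where
  field
    n      : ℕ
    arc    : Fin n → Fin n → Bool
    irrefl : ∀ u → arc u u ≡ false
    asym   : ∀ u v → arc u v ≡ true → arc v u ≡ false
open OGraph public

IsHom : (G H : OGraph) → (Fin (n G) → Fin (n H)) → Set
IsHom G H φ = ∀ u v → arc G u v ≡ true → arc H (φ u) (φ v) ≡ true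

IsSimpleHom : (G H : OGraph) → (Fin (n G) → Fin (n H)) → Set
IsSimpleHom G H φ =
  n G ≡ 1 ⊎
  ((Σ (Fin (n G)) λ u → Σ (Fin (n G)) λ v → φ u ≢ φ v) ×
   (∀ u v → arc G u v ≡ true → φ u ≢ φ v → arc H (φ u) (φ v) ≡ true))

HasChi : OGraph → ℕ → Set
HasChi G k =
  (Σ OGraph λ H → (n H ≡ k) × Σ (Fin (n G) → Fin (n H)) λ φ → IsHom G H φ) ×
  (∀ H (φ : Fin (n G) → Fin (n H)) → IsHom G H φ → k ≤ n H)

HasChiS : OGraph → ℕ → Set
HasChiS G k =
  (Σ OGraph λ H → (n H ≡ k) × Σ (Fin (n G) → Fin (n H)) λ φ → IsSimpleHom G H φ) ×
  (∀ H (φ : Fin (n G) → Fin (n H)) → IsSimpleHom G H φ → k ≤ n H)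

-- Parameter of a family: maximum over the family, ∞ (= nothing) if no
-- maximum exists.  `param G k` expresses "the parameter of G is k".

IsMaxOver : (OGraph → Set) → (OGraph → ℕ → Set) → ℕ → Set
IsMaxOver F param k =
  (Σ OGraph λ G → F G × param G k) ×
  (∀ G j → F G → param G j → j ≤ k)

FamilyValue : (OGraph → Set) → (OGraph → ℕ → Set) → Maybe ℕ → Set
FamilyValue F param (just k) = IsMaxOver F param k
FamilyValue F param nothing  = ¬ (Σ ℕ λ k → IsMaxOver F param k)

FamilyChi : (OGraph → Set) → Maybe ℕ → Set
FamilyChi F = FamilyValue F HasChi

FamilyChiS : (OGraph → Set) → Maybe ℕ → Set
FamilyChiS F = FamilyValue F HasChiS

OptimallySimplyColourable : (OGraph → Set) → Set
OptimallySimplyColourable F =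
  Σ (Maybe ℕ) λ v → FamilyChi F v × FamilyChiS F v

-- The new vertex is `zero`, old vertices
-- are shifted by `suc`.

K2 : Fin 2 → Fin 2 → Bool
K2 zero zero             = false
K2 zero (suc zero)       = true
K2 (suc zero) zero       = true
K2 (suc zero) (suc zero) = false

extend : ∀ {m} → (Fin m → Fin m → Bool) → Fin m → Fin m →
         Fin (suc m) → Fin (suc m) → Bool
extend E a b zero    zero    = false
extend E a b zero    (suc j) = ⌊ j ≟ a ⌋ ∨ ⌊ j ≟ b ⌋
extend E a b (suc i) zero    = ⌊ i ≟ a ⌋ ∨ ⌊ i ≟ b ⌋
extend E a b (suc i) (suc j) = E i j

data TwoTree : (m : ℕ) → (Fin m → Fin m → Bool) → Set where
  base : TwoTree 2 K2
  add  : ∀ {m E} → TwoTree m E → (a b : Fin m) → E a b ≡ true →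
         TwoTree (suc m) (extend E a b)

Adjacent : (G : OGraph) → Fin (n G) → Fin (n G) → Set
Adjacent G u v = arc G u v ≡ true ⊎ arc G v u ≡ true

-- The underlying graph of G is a partial 2-tree: it is (isomorphic to)
-- a subgraph of a 2-tree, i.e. it embeds injectively into a 2-tree
-- with edges mapped to edges.
IsPartial2Tree : OGraph → Set
IsPartial2Tree G =
  Σ ℕ λ m → Σ (Fin m → Fin m → Bool) λ E → TwoTree m E ×
  Σ (Fin (n G) → Fin m) λ f →
    (∀ u v → f u ≡ f v → u ≡ v) ×
    (∀ u v → Adjacent G u v → E (f u) (f v) ≡ true)

module Submission where

-- The oriented 2-tree G4 below has every two vertices joined by an arc or a directed 2-path, so every
-- homomorphism from it is injective and χ(G4) = 4. On the other hand every partial 2-tree with at least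
-- two vertices has a simple homomorphism onto the directed triangle C3 using two colours. This follows,
-- by induction along the construction of the host 2-tree, from the stronger claim that any colouring of
-- one edge compatible with its arc extends to a C3-colouring of the whole 2-tree: a new vertex has only
-- two neighbours, and each coloured neighbour forbids at most one of the three colours. So χ_s ≤ 3 < 4 ≤ χ
-- on the family, and since the χ_s-values are bounded and attained they cannot lack a maximum.

open import Defs
open import Data.Nat using (ℕ; zero; suc; _≤_; s≤s⁻¹)
open import Data.Nat.Properties using (≤∧≢⇒<; n≤0⇒n≡0; ≤-trans; <-irrefl)
open import Data.Fin using (Fin; zero; suc; _≟_)
open import Data.Fin.Properties using (any?; all?; injective⇒≤; 0≢1+n)
open import Data.Bool using (Bool; true; false)
open import Data.Bool.Properties using () renaming (_≟_ to _≟ᵇ_)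
open import Data.Vec.Functional using (_∷_)
open import Data.Product using (Σ; ∃; _×_; _,_; proj₁; proj₂; swap)
open import Data.Sum using (_⊎_; inj₁; inj₂)
open import Data.Maybe using (just; nothing)
open import Function using (_∘_)
open import Function.Definitions using (Injective)
open import Relation.Nullary using (¬_; Dec; yes; no; does; contradiction)
open import Relation.Nullary.Decidable using (dec-true; dec-false; from-yes; _×-dec_; _⊎-dec_; _→-dec_; ¬?)
open import Relation.Binary.PropositionalEquality using (_≡_; _≢_; refl; sym; trans; cong; subst; subst₂)

≡true⇒≢false : ∀ {b} → b ≡ true → b ≢ false
≡true⇒≢false refl ()

witness : ∀ {A : Set} (a? : Dec A) → does a? ≡ true → A
witness (yes a) _ = a

next : Fin 3 → Fin 3
next zero             = suc zero
next (suc zero)       = suc (suc zero)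
next (suc (suc zero)) = zero

C3 : OGraph
C3 = record
  { n      = 3
  ; arc    = λ c d → does (next c ≟ d)
  ; irrefl = from-yes (all? λ c → does (next c ≟ c) ≟ᵇ false)
  ; asym   = from-yes (all? λ c → all? λ d →
               (does (next c ≟ d) ≟ᵇ true) →-dec (does (next d ≟ c) ≟ᵇ false))
  }

-- Facts checked by evaluation; opaque so that type checking never unfolds their proofs.
opaque
  next³ : ∀ c → next (next (next c)) ≡ c
  next³ = from-yes (all? λ c → next (next (next c)) ≟ c)

  cyclic : ∀ c d → d ≡ c ⊎ d ≡ next c ⊎ d ≡ next (next c)
  cyclic = from-yes (all? λ c → all? λ d → (d ≟ c) ⊎-dec (d ≟ next c) ⊎-dec (d ≟ next (next c)))

  avoid₂ : ∀ (a b : Fin 3) → ∃ λ c → c ≢ a × c ≢ b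
  avoid₂ = from-yes (all? λ a → all? λ b → any? λ (c : Fin 3) → ¬? (c ≟ a) ×-dec ¬? (c ≟ b))

arc-next : ∀ {c d} → next c ≡ d → arc C3 c d ≡ true
arc-next {c} {d} = dec-true (next c ≟ d)

C3-arc-unless-next : ∀ {c d} → c ≢ d → c ≢ next d → arc C3 c d ≡ true
C3-arc-unless-next {c} {d} c≢d c≢nd with cyclic c d
... | inj₁ d≡c         = contradiction (sym d≡c) c≢d
... | inj₂ (inj₁ d≡nc)  = arc-next (sym d≡nc)
... | inj₂ (inj₂ d≡nnc) = contradiction (trans (sym (next³ c)) (cong next (sym d≡nnc))) c≢nd

IsAsymmetric : ∀ {m} → (Fin m → Fin m → Bool) → Set
IsAsymmetric R = ∀ u v → R u v ≡ true → R v u ≡ false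

_⊆₂_ : ∀ {m} → (R E : Fin m → Fin m → Bool) → Set
R ⊆₂ E = ∀ u v → R u v ≡ true → E u v ≡ true

restrict : ∀ {m} → (Fin (suc m) → Fin (suc m) → Bool) → Fin m → Fin m → Bool
restrict R u v = R (suc u) (suc v)

ArcFits : Bool → Fin 3 → Fin 3 → Set
ArcFits r c d = r ≡ true → c ≢ d → arc C3 c d ≡ true

Fits : ∀ {m} → (Fin m → Fin m → Bool) → Fin m → Fin m → Fin 3 → Fin 3 → Set
Fits R u v c d = ArcFits (R u v) c d × ArcFits (R v u) d c

IsColouring : ∀ {m} → (Fin m → Fin m → Bool) → (Fin m → Fin 3) → Set
IsColouring R ψ = ∀ u v → ArcFits (R u v) (ψ u) (ψ v)

arcFits-diag : ∀ {r c} → ArcFits r c c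
arcFits-diag _ c≢c = contradiction refl c≢c

reverse-fits : ∀ {m} {R : Fin m → Fin m → Bool} → IsAsymmetric R → ∀ {u v} → R u v ≡ true →
               ∀ {c d} → ArcFits (R v u) d c
reverse-fits asym uv vu = contradiction (asym _ _ uv) (≡true⇒≢false vu)

fits-along-arc : ∀ {m} {R : Fin m → Fin m → Bool} → IsAsymmetric R → ∀ {u v} → R u v ≡ true →
                 ∀ {c} → Fits R u v c (next c)
fits-along-arc asym uv {c} = (λ _ _ → arc-next {c} refl) , reverse-fits asym uv

forbidden : Bool → Fin 3 → Fin 3
forbidden true  d = next d
forbidden false d = next (next d)

fits-unless-forbidden : ∀ {m} {R : Fin m → Fin m → Bool} → IsAsymmetric R →
                        ∀ u v {c d} → c ≢ forbidden (R u v) d → Fits R u v c d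
fits-unless-forbidden {R = R} asym u v {c} {d} c≢f with R u v in uv
... | true  = (λ _ c≢d → C3-arc-unless-next c≢d c≢f) , reverse-fits asym uv
... | false = (λ ()) ,
              (λ _ d≢c → C3-arc-unless-next d≢c λ d≡nc →
                 c≢f (trans (sym (next³ c)) (cong (next ∘ next) (sym d≡nc))))

fitting-colour : ∀ {m} {R : Fin m → Fin m → Bool} → IsAsymmetric R →
                 ∀ u v w (d e : Fin 3) → ∃ λ c → Fits R u v c d × Fits R u w c e
fitting-colour {R = R} asym u v w d e
  with c , c≢f₁ , c≢f₂ ← avoid₂ (forbidden (R u v) d) (forbidden (R u w) e)
  = c , fits-unless-forbidden asym u v c≢f₁ , fits-unless-forbidden asym u w c≢f₂

twoTree-symmetric : ∀ {m E} → TwoTree m E → ∀ u v → E u v ≡ true → E v u ≡ true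
twoTree-symmetric base          zero       zero       ()
twoTree-symmetric base          zero       (suc zero) e = e
twoTree-symmetric base          (suc zero) zero       e = e
twoTree-symmetric base          (suc zero) (suc zero) ()
twoTree-symmetric (add t a b _) zero       zero       ()
twoTree-symmetric (add t a b _) zero       (suc v)    e = e
twoTree-symmetric (add t a b _) (suc u)    zero       e = e
twoTree-symmetric (add t a b _) (suc u)    (suc v)    e = twoTree-symmetric t u v e

new-vertex-neighbours : ∀ {m E} {a b : Fin m} x → extend E a b zero (suc x) ≡ true → x ≡ a ⊎ x ≡ b
new-vertex-neighbours {a = a} {b} x e with x ≟ a | x ≟ b
... | yes x≡a | _       = inj₁ x≡a
... | no _    | yes x≡b = inj₂ x≡b
... | no _    | no _    = contradiction e λ ()

ColouringWith : ∀ {m} → (Fin m → Fin m → Bool) → Fin m → Fin m → Fin 3 → Fin 3 → Set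
ColouringWith {m} R u v c d = Σ (Fin m → Fin 3) λ ψ → IsColouring R ψ × ψ u ≡ c × ψ v ≡ d

EdgePrecolourable : ∀ m → (Fin m → Fin m → Bool) → Set
EdgePrecolourable m E =
  ∀ (R : Fin m → Fin m → Bool) → IsAsymmetric R → R ⊆₂ E →
  ∀ u v → E u v ≡ true → ∀ c d → Fits R u v c d → ColouringWith R u v c d

colouring-K2 : ∀ {R : Fin 2 → Fin 2 → Bool} {c d} → Fits R zero (suc zero) c d →
               IsColouring R (c ∷ λ _ → d)
colouring-K2 fits zero       zero       = arcFits-diag
colouring-K2 fits zero       (suc zero) = proj₁ fits
colouring-K2 fits (suc zero) zero       = proj₂ fits
colouring-K2 fits (suc zero) (suc zero) = arcFits-diag

K2-precolourable : EdgePrecolourable 2 K2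
K2-precolourable R _ _ zero       zero       ()
K2-precolourable R _ _ zero       (suc zero) _ c d fits = (c ∷ λ _ → d) , colouring-K2 fits , refl , refl
K2-precolourable R _ _ (suc zero) zero       _ c d fits = (d ∷ λ _ → c) , colouring-K2 (swap fits) , refl , refl
K2-precolourable R _ _ (suc zero) (suc zero) ()

extend-colouring : ∀ {m E a b} {R : Fin (suc m) → Fin (suc m) → Bool} {ψ : Fin m → Fin 3} {c} →
                   R ⊆₂ extend E a b → IsColouring (restrict R) ψ →
                   Fits R zero (suc a) c (ψ a) → Fits R zero (suc b) c (ψ b) → IsColouring R (c ∷ ψ)
extend-colouring R⊆E col fa fb zero    zero    = arcFits-diag
extend-colouring R⊆E col fa fb (suc u) (suc v) = col u v
extend-colouring {E = E} R⊆E col fa fb zero (suc x) r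
  with new-vertex-neighbours {E = E} x (R⊆E zero (suc x) r)
... | inj₁ refl = proj₁ fa r
... | inj₂ refl = proj₁ fb r
extend-colouring {E = E} R⊆E col fa fb (suc x) zero r
  with new-vertex-neighbours {E = E} x (R⊆E (suc x) zero r)
... | inj₁ refl = proj₂ fa r
... | inj₂ refl = proj₂ fb r

extend-precolourable : ∀ {m E a b} → EdgePrecolourable m E → E a b ≡ true → E b a ≡ true →
                       EdgePrecolourable (suc m) (extend E a b)
extend-precolourable {m} {E} {a} {b} precolour eab eba R asym R⊆E = edge
  where
  precolour-old : ∀ u v → E u v ≡ true → ∀ c d → Fits (restrict R) u v c d →
                  ColouringWith (restrict R) u v c d
  precolour-old = precolour (restrict R) (λ u v → asym (suc u) (suc v)) (λ u v → R⊆E (suc u) (suc v))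

  -- w is first given a colour fitting both the new vertex and y; then the old tree is precoloured on y w.
  precolour-triangle : ∀ y w → E y w ≡ true → ∀ c d → Fits R zero (suc y) c d →
                       Σ (Fin m → Fin 3) λ ψ → IsColouring (restrict R) ψ × ψ y ≡ d ×
                         Fits R zero (suc y) c (ψ y) × Fits R zero (suc w) c (ψ w)
  precolour-triangle y w eyw c d fy
    with d′ , fz , fy′ ← fitting-colour asym (suc w) zero (suc y) c d
    with ψ , col , ψy , ψw ← precolour-old y w eyw d d′ (swap fy′)
    = ψ , col , ψy , subst (Fits R zero (suc y) c) (sym ψy) fy ,
      subst (Fits R zero (suc w) c) (sym ψw) (swap fz)

  from-new : ∀ y → extend E a b zero (suc y) ≡ true → ∀ c d → Fits R zero (suc y) c d →
             ColouringWith R zero (suc y) c d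
  from-new y e c d fy with new-vertex-neighbours {E = E} y e
  ... | inj₁ refl with ψ , col , ψy , fa , fb ← precolour-triangle a b eab c d fy
    = (c ∷ ψ) , extend-colouring R⊆E col fa fb , refl , ψy
  ... | inj₂ refl with ψ , col , ψy , fb , fa ← precolour-triangle b a eba c d fy
    = (c ∷ ψ) , extend-colouring R⊆E col fa fb , refl , ψy

  edge : ∀ u v → extend E a b u v ≡ true → ∀ c d → Fits R u v c d → ColouringWith R u v c d
  edge zero    zero    ()
  edge zero    (suc y) e c d fits = from-new y e c d fits
  edge (suc y) zero    e c d fits with ψ , col , ψz , ψy ← from-new y e d c (swap fits)
    = ψ , col , ψy , ψz
  edge (suc u) (suc v) e c d fits
    with ψ , col , ψu , ψv ← precolour-old u v e c d fits
    with c₀ , fa , fb ← fitting-colour asym zero (suc a) (suc b) (ψ a) (ψ b)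
    = (c₀ ∷ ψ) , extend-colouring R⊆E col fa fb , ψu , ψv

twoTree-precolourable : ∀ {m E} → TwoTree m E → EdgePrecolourable m E
twoTree-precolourable base            = K2-precolourable
twoTree-precolourable (add t a b eab) =
  extend-precolourable (twoTree-precolourable t) eab (twoTree-symmetric t a b eab)

module _ (G : OGraph) {m : ℕ} (f : Fin (n G) → Fin m) where

  ImageArc : Fin m → Fin m → Set
  ImageArc p q = ∃ λ u → ∃ λ v → f u ≡ p × f v ≡ q × arc G u v ≡ true

  imageArc? : ∀ p q → Dec (ImageArc p q)
  imageArc? p q = any? λ u → any? λ v → (f u ≟ p) ×-dec (f v ≟ q) ×-dec (arc G u v ≟ᵇ true)

  imageArc : Fin m → Fin m → Bool
  imageArc p q = does (imageArc? p q)

  imageArc-of : ∀ {u v} → arc G u v ≡ true → imageArc (f u) (f v) ≡ true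
  imageArc-of {u} {v} uv = dec-true (imageArc? (f u) (f v)) (u , v , refl , refl , uv)

  imageArc-asym : (∀ u v → f u ≡ f v → u ≡ v) → IsAsymmetric imageArc
  imageArc-asym f-inj p q pq
    with u , v , refl , refl , uv ← witness (imageArc? p q) pq
    = dec-false (imageArc? (f v) (f u)) λ (v′ , u′ , fv′≡fv , fu′≡fu , v′u′) →
        ≡true⇒≢false (subst₂ (λ x y → arc G x y ≡ true) (f-inj _ _ fv′≡fv) (f-inj _ _ fu′≡fu) v′u′)
                     (asym G u v uv)

  imageArc-⊆ : ∀ {E : Fin m → Fin m → Bool} → (∀ u v → Adjacent G u v → E (f u) (f v) ≡ true) →
               imageArc ⊆₂ E
  imageArc-⊆ f-adj p q pq
    with u , v , refl , refl , uv ← witness (imageArc? p q) pq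
    = f-adj u v (inj₁ uv)

indicator : ∀ {k} → Fin k → Fin k → Fin 3
indicator x w with w ≟ x
... | yes _ = suc zero
... | no _  = zero

indicator-separates : ∀ {k} {x y : Fin k} → x ≢ y → indicator x x ≢ indicator x y
indicator-separates {x = x} {y} x≢y with x ≟ x | y ≟ x
... | no x≢x | _       = contradiction refl x≢x
... | _      | yes y≡x = contradiction (sym y≡x) x≢y
... | yes _  | no _    = λ ()

simpleHom-from-arc : ∀ {G} → IsPartial2Tree G → ∀ {u v} → arc G u v ≡ true →
                     Σ (Fin (n G) → Fin 3) (IsSimpleHom G C3)
simpleHom-from-arc {G} (m , E , t , f , f-inj , f-adj) {u} {v} uv =
  let ψ , colouring , ψu , ψv = twoTree-precolourable t (imageArc G f) image-asym (imageArc-⊆ G f f-adj)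
                                  (f u) (f v) (f-adj u v (inj₁ uv)) zero (suc zero)
                                  (fits-along-arc image-asym (imageArc-of G f uv))
  in ψ ∘ f , inj₂ ((u , v , λ ψfu≡ψfv → 0≢1+n (trans (sym ψu) (trans ψfu≡ψfv ψv))) ,
                   λ u′ v′ u′v′ → colouring (f u′) (f v′) (imageArc-of G f u′v′))
  where
  image-asym : IsAsymmetric (imageArc G f)
  image-asym = imageArc-asym G f f-inj

simpleHom-to-C3 : ∀ {G} → IsPartial2Tree G → ∀ {x y : Fin (n G)} → x ≢ y →
                  Σ (Fin (n G) → Fin 3) (IsSimpleHom G C3)
simpleHom-to-C3 {G} P {x} {y} x≢y with any? (λ u → any? λ v → arc G u v ≟ᵇ true)
... | yes (u , v , uv) = simpleHom-from-arc {G} P uv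
... | no arcless =
  indicator x , inj₂ ((x , y , indicator-separates x≢y) , λ u v uv _ → contradiction (u , v , uv) arcless)

χs≤3 : ∀ {G j} → IsPartial2Tree G → HasChiS G j → j ≤ 3
χs≤3 _ ((_ , _ , _ , inj₁ single) , least) = least C3 (λ _ → zero) (inj₁ single)
χs≤3 {G} P ((_ , _ , φ , inj₂ ((x , y , φx≢φy) , _)) , least)
  with ψ , simple ← simpleHom-to-C3 {G} P (λ x≡y → φx≢φy (cong φ x≡y))
  = least C3 ψ simple

arc-≢ : ∀ H {x y} → arc H x y ≡ true → x ≢ y
arc-≢ H {x} xy refl = ≡true⇒≢false xy (irrefl H x)

twoPath-≢ : ∀ H {x w y} → arc H x w ≡ true → arc H w y ≡ true → x ≢ y
twoPath-≢ H {x} {w} xw wx refl = ≡true⇒≢false wx (asym H x w xw)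

TwoPath : (G : OGraph) → Fin (n G) → Fin (n G) → Set
TwoPath G u v = ∃ λ w → arc G u w ≡ true × arc G w v ≡ true

IsOrientedClique : OGraph → Set
IsOrientedClique G = ∀ u v → u ≡ v ⊎ Adjacent G u v ⊎ TwoPath G u v ⊎ TwoPath G v u

adjacent? : ∀ G u v → Dec (Adjacent G u v)
adjacent? G u v = (arc G u v ≟ᵇ true) ⊎-dec (arc G v u ≟ᵇ true)

twoPath? : ∀ G u v → Dec (TwoPath G u v)
twoPath? G u v = any? λ w → (arc G u w ≟ᵇ true) ×-dec (arc G w v ≟ᵇ true)

isOrientedClique? : ∀ G → Dec (IsOrientedClique G)
isOrientedClique? G = all? λ u → all? λ v →
  (u ≟ v) ⊎-dec adjacent? G u v ⊎-dec twoPath? G u v ⊎-dec twoPath? G v u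

clique-hom-injective : ∀ {G H φ} → IsOrientedClique G → IsHom G H φ → Injective _≡_ _≡_ φ
clique-hom-injective {H = H} clique hom {u} {v} φu≡φv with clique u v
... | inj₁ u≡v                         = u≡v
... | inj₂ (inj₁ (inj₁ uv))            = contradiction φu≡φv (arc-≢ H (hom u v uv))
... | inj₂ (inj₁ (inj₂ vu))            = contradiction (sym φu≡φv) (arc-≢ H (hom v u vu))
... | inj₂ (inj₂ (inj₁ (w , uw , wv))) = contradiction φu≡φv (twoPath-≢ H (hom u w uw) (hom w v wv))
... | inj₂ (inj₂ (inj₂ (w , vw , wu))) = contradiction (sym φu≡φv) (twoPath-≢ H (hom v w vw) (hom w u wu))

χ-clique : ∀ {G} → IsOrientedClique G → HasChi G (n G)
χ-clique {G} clique =
  (G , refl , (λ u → u) , (λ _ _ uv → uv)) ,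
  λ H φ hom → injective⇒≤ {f = φ} (clique-hom-injective {G} {H} {φ} clique hom)

-- The triangle 1 2 3 with 0 attached to the edge 2 3.
E4 : Fin 4 → Fin 4 → Bool
E4 = extend (extend K2 zero (suc zero)) (suc zero) (suc (suc zero))

E4-twoTree : TwoTree 4 E4
E4-twoTree = add (add base zero (suc zero) refl) (suc zero) (suc (suc zero)) refl

-- An orientation of E4; its non-adjacent vertices 0 and 1 are joined by the path 0 → 2 → 1.
g4 : Fin 4 → Fin 4 → Bool
g4 zero                    (suc (suc zero))          = true
g4 (suc (suc zero))        (suc zero)                = true
g4 (suc (suc zero))        (suc (suc (suc zero)))    = true
g4 (suc zero)              (suc (suc (suc zero)))    = true
g4 (suc (suc (suc zero)))  zero                      = true
g4 _                       _                         = false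

G4 : OGraph
G4 = record
  { n      = 4
  ; arc    = g4
  ; irrefl = from-yes (all? λ u → g4 u u ≟ᵇ false)
  ; asym   = from-yes (all? λ u → all? λ v → (g4 u v ≟ᵇ true) →-dec (g4 v u ≟ᵇ false))
  }

G4-partial2Tree : IsPartial2Tree G4
G4-partial2Tree = 4 , E4 , E4-twoTree , (λ u → u) , (λ _ _ u≡v → u≡v) ,
  from-yes (all? λ u → all? λ v → adjacent? G4 u v →-dec (E4 u v ≟ᵇ true))

χ-G4 : HasChi G4 4
χ-G4 = χ-clique {G4} (from-yes (isOrientedClique? G4))

K1 : OGraph
K1 = record { n = 1 ; arc = λ _ _ → false ; irrefl = λ _ → refl ; asym = λ _ _ () }

K1-partial2Tree : IsPartial2Tree K1
K1-partial2Tree =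
  2 , K2 , base , (λ _ → zero) , (λ { zero zero _ → refl }) , λ _ _ → λ { (inj₁ ()) ; (inj₂ ()) }

χs-K1 : HasChiS K1 1
χs-K1 = (K1 , refl , (λ u → u) , inj₁ refl) , λ H φ _ → injective⇒≤ {f = φ} λ { {zero} {zero} _ → refl }

IsMaximum : (ℕ → Set) → ℕ → Set
IsMaximum P k = P k × (∀ j → P j → j ≤ k)

bounded⇒¬¬maximum : ∀ {P : ℕ → Set} b → (∀ j → P j → j ≤ b) → ∃ P → ¬ ¬ ∃ (IsMaximum P)
bounded⇒¬¬maximum {P} zero    bounded (j , pj) noMax =
  noMax (0 , subst P (n≤0⇒n≡0 (bounded j pj)) pj , bounded)
bounded⇒¬¬maximum {P} (suc b) bounded p noMax = bounded⇒¬¬maximum b bounded′ p noMax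
  where
  bounded′ : ∀ j → P j → j ≤ b
  bounded′ j pj = s≤s⁻¹ (≤∧≢⇒< (bounded j pj) λ { refl → noMax (suc b , pj , bounded) })

Attains : (OGraph → Set) → (OGraph → ℕ → Set) → ℕ → Set
Attains F param j = ∃ λ G → F G × param G j

bounded⇒familyValue-finite : ∀ {F param j} b → (∀ G j → F G → param G j → j ≤ b) →
                             Attains F param j → ¬ FamilyValue F param nothing
bounded⇒familyValue-finite {j = j} b bounded attained noMax =
  bounded⇒¬¬maximum b (λ j (G , FG , pG) → bounded G j FG pG) (j , attained)
    λ (k , attainedₖ , maximal) → noMax (k , attainedₖ , λ G j FG pG → maximal j (G , FG , pG))

mainTheorem18 : ¬ OptimallySimplyColourable IsPartial2Tree
mainTheorem18 (nothing , _ , χs-infinite) =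
  bounded⇒familyValue-finite 3 (λ G _ → χs≤3 {G}) (K1 , K1-partial2Tree , χs-K1) χs-infinite
mainTheorem18 (just k , (_ , χ≤k) , ((G , G-partial2Tree , χs-G) , _)) =
  <-irrefl refl (≤-trans (χ≤k G4 4 G4-partial2Tree χ-G4) (χs≤3 {G} G-partial2Tree χs-G))
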